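{- Let $d\geq 3$ and let $G$ be a finite, simple, connected $d$-regular graph. Then $\chi^o(G)\in\{1,2\}$.
   Context: All graphs are finite, simple and connected. An oriented edge $[v,w]$ is an edge $\{v,w\}$ with input $v$ and output $w$; $\mathcal{O}=\{[v,w],[w,v]: v\sim w\}$. For $k\geq 1$, $G$ is circularly $k$-partite if $\mathcal{O}$ can be partitioned as $\mathcal{O}=\mathcal{O}_1\sqcup\cdots\sqcup\mathcal{O}_k$ with all $\mathcal{O}_j$ non-empty and such that $[v,w]\in\mathcal{O}_j$ implies $[w,z]\in\mathcal{O}_{j+1}$ for every $z\sim w$ with $z\neq v$, indices modulo $k$. The oriented edge periodic colouring number $\chi^o(G)$ is the largest $k$ such that $G$ is circularly $k$-partite. -}

module Defs where

open import Data.Nat using (ℕ; zero; suc; _+_; _≤_; _<_; NonZero)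
open import Data.Nat.DivMod using (_%_)
open import Data.Fin using (Fin; toℕ)
open import Data.Bool using (Bool; true; false; T; if_then_else_)
open import Data.List using (List; map; allFin)
open import Data.Nat.ListAction using (sum)
open import Data.Empty using (⊥)
open import Data.Product using (Σ; ∃; _×_; _,_)
open import Relation.Binary.PropositionalEquality using (_≡_; _≢_)

record Graph : Set where
  field
    n      : ℕ
    adj    : Fin n → Fin n → Bool
    adj-sym    : ∀ v w → adj v w ≡ adj w v
    adj-irrefl : ∀ v → adj v v ≡ false

open Graph public

Adj : (G : Graph) → Fin (n G) → Fin (n G) → Set
Adj G v w = T (adj G v w)

data Reach (G : Graph) : Fin (n G) → Fin (n G) → Set where
  here  : ∀ {v} → Reach G v v
  step  : ∀ {u v w} → Adj G u v → Reach G v w → Reach G u w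

Connected : Graph → Set
Connected G = (0 < n G) × (∀ v w → Reach G v w)

degree : (G : Graph) → Fin (n G) → ℕ
degree G v = sum (map (λ w → if adj G v w then 1 else 0) (allFin (n G)))

Regular : ℕ → Graph → Set
Regular d G = ∀ v → degree G v ≡ d

-- A partition of the oriented edges O into k classes O_0,...,O_{k-1}
-- is a colouring c assigning to each oriented edge [v,w] (v ∼ w) a
-- class in Fin k.
CircularlyPartite : (G : Graph) → (k : ℕ) → Set
CircularlyPartite G zero    = ⊥
CircularlyPartite G (suc m) =
  Σ ((v w : Fin (n G)) → Adj G v w → Fin (suc m)) λ c →
    (∀ (j : Fin (suc m)) → Σ (Fin (n G)) λ v → Σ (Fin (n G)) λ w →
        Σ (Adj G v w) λ p → c v w p ≡ j)
    × (∀ v w z (p : Adj G v w) (q : Adj G w z) → z ≢ v →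
        toℕ (c w z q) ≡ suc (toℕ (c v w p)) % suc m)

IsOrientedEdgePeriodicColouringNumber : Graph → ℕ → Set
IsOrientedEdgePeriodicColouringNumber G k =
  CircularlyPartite G k × (∀ k′ → CircularlyPartite G k′ → k′ ≤ k)

-- Each vertex has at least three neighbours, so any two oriented edges [w,a]
-- and [w,b] leaving w have a common predecessor [u,w] with u ∉ {a,b}; hence
-- all edges leaving a vertex carry the same colour.  Then [w,v] has the
-- colour of [v,w] plus one and vice versa, so adding 2 is the identity
-- modulo k, whence k ≤ 2.  A circular 2-partition is the same as a
-- bipartition of the vertices (colour an edge by the side of its input), and
-- the trivial 1-partition always exists, so χᵒ(G) is 2 or 1 according as G is
-- bipartite or not.  Connectedness is only used to know that G has a vertex.
module Submission where

open import Defs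
open import Data.Bool using (Bool; true; false; T; if_then_else_)
open import Data.Bool.Properties using (T?) renaming (_≟_ to _≟ᵇ_)
open import Data.Empty using (⊥-elim)
open import Data.Fin using (Fin; zero; suc; toℕ; fromℕ<)
open import Data.Fin.Patterns using (0F; 1F)
open import Data.Fin.Properties using (any?; all?; toℕ-injective; _≟_; 2↔Bool)
open import Data.Fin.Subset using (Subset)
open import Data.Fin.Subset.Properties using (anySubset?)
open import Data.List using (tabulate)
open import Data.List.Properties using (map-tabulate)
open import Data.Nat using (ℕ; zero; suc; _+_; _*_; _≤_; z≤n; s≤s; s≤s⁻¹; NonZero)
open import Data.Nat.DivMod using (_%_; _/_; %-distribˡ-+; m%n%n≡m%n; m≡m%n+[m/n]*n)
open import Data.Nat.Divisibility using (_∣_; divides; ∣⇒≤)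
open import Data.Nat.ListAction using (sum)
open import Data.Nat.Properties
  using ( +-commutativeSemigroup; +-comm; +-mono-≤; +-cancelʳ-≡; m≤m+n; m≤n+m
        ; ≤-trans; ≤-reflexive; ≤∧≢⇒<; module ≤-Reasoning)
open import Algebra.Properties.CommutativeSemigroup +-commutativeSemigroup using (interchange)
open import Data.Product using (Σ; ∃-syntax; _×_; _,_; proj₁; proj₂)
open import Data.Sum using (_⊎_; inj₁; inj₂)
open import Data.Unit using (tt)
open import Data.Vec using (lookup) renaming (tabulate to tabulateᵛ)
open import Data.Vec.Properties using (lookup∘tabulate)
open import Function using (_∘_; id; Inverse)
open import Relation.Nullary using (¬_; Dec; yes; no; does)
open import Relation.Nullary.Decidable using (dec-true; _→-dec_; ¬?; _×-dec_)
open import Relation.Binary.PropositionalEquality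

open Inverse 2↔Bool using () renaming (to to fin2→bool; from to bool→fin2)

[1+m%n]%n≡[1+m]%n : ∀ m n .{{_ : NonZero n}} → suc (m % n) % n ≡ suc m % n
[1+m%n]%n≡[1+m]%n m n = begin
  (1 + m % n) % n          ≡⟨ %-distribˡ-+ 1 (m % n) n ⟩
  (1 % n + m % n % n) % n  ≡⟨ cong (λ r → (1 % n + r) % n) (m%n%n≡m%n m n) ⟩
  (1 % n + m % n) % n      ≡⟨ %-distribˡ-+ 1 m n ⟨
  (1 + m) % n              ∎
  where open ≡-Reasoning

m≡[o+m]%n⇒n∣o : ∀ m n o .{{_ : NonZero n}} → m ≡ (o + m) % n → n ∣ o
m≡[o+m]%n⇒n∣o m n o m≡[o+m]%n = divides ((o + m) / n) (+-cancelʳ-≡ m o _ (begin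
  o + m                          ≡⟨ m≡m%n+[m/n]*n (o + m) n ⟩
  (o + m) % n + (o + m) / n * n  ≡⟨ cong (_+ (o + m) / n * n) m≡[o+m]%n ⟨
  m + (o + m) / n * n            ≡⟨ +-comm m _ ⟩
  (o + m) / n * n + m            ∎))
  where open ≡-Reasoning

m≡[1+n]%o∧n≡[1+m]%o⇒o≤2 : ∀ {m n} o .{{_ : NonZero o}} →
                          m ≡ suc n % o → n ≡ suc m % o → o ≤ 2
m≡[1+n]%o∧n≡[1+m]%o⇒o≤2 {m} {n} o m≡ n≡ = ∣⇒≤ (m≡[o+m]%n⇒n∣o n o 2 (begin
  n                    ≡⟨ n≡ ⟩
  suc m % o            ≡⟨ cong (λ r → suc r % o) m≡ ⟩
  suc (suc n % o) % o  ≡⟨ [1+m%n]%n≡[1+m]%n (suc n) o ⟩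
  (2 + n) % o          ∎))
  where open ≡-Reasoning

bool→fin2-covers : ∀ {a b} → a ≢ b → ∀ j → bool→fin2 a ≡ j ⊎ bool→fin2 b ≡ j
bool→fin2-covers {false} {false} a≢b _     = ⊥-elim (a≢b refl)
bool→fin2-covers {false} {true}  _ 0F      = inj₁ refl
bool→fin2-covers {false} {true}  _ 1F      = inj₂ refl
bool→fin2-covers {true}  {false} _ 0F      = inj₂ refl
bool→fin2-covers {true}  {false} _ 1F      = inj₁ refl
bool→fin2-covers {true}  {true}  a≢b _     = ⊥-elim (a≢b refl)

bool→fin2-successor : ∀ {a b} → a ≢ b → toℕ (bool→fin2 b) ≡ suc (toℕ (bool→fin2 a)) % 2
bool→fin2-successor {false} {false} a≢b = ⊥-elim (a≢b refl)
bool→fin2-successor {false} {true}  _   = refl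
bool→fin2-successor {true}  {false} _   = refl
bool→fin2-successor {true}  {true}  a≢b = ⊥-elim (a≢b refl)

successor-mod-2⇒fin2→bool-≢ : ∀ i j → toℕ j ≡ suc (toℕ i) % 2 → fin2→bool i ≢ fin2→bool j
successor-mod-2⇒fin2→bool-≢ 0F 0F ()
successor-mod-2⇒fin2→bool-≢ 0F 1F _ ()
successor-mod-2⇒fin2→bool-≢ 1F 0F _ ()
successor-mod-2⇒fin2→bool-≢ 1F 1F ()

sum-tabulate-mono : ∀ {n} {f g : Fin n → ℕ} → (∀ i → f i ≤ g i) →
                    sum (tabulate f) ≤ sum (tabulate g)
sum-tabulate-mono {zero}  _   = z≤n
sum-tabulate-mono {suc n} f≤g = +-mono-≤ (f≤g zero) (sum-tabulate-mono (f≤g ∘ suc))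

sum-tabulate-+ : ∀ {n} (f g : Fin n → ℕ) →
                 sum (tabulate (λ i → f i + g i)) ≡ sum (tabulate f) + sum (tabulate g)
sum-tabulate-+ {zero}  f g = refl
sum-tabulate-+ {suc n} f g =
  trans (cong (f zero + g zero +_) (sum-tabulate-+ (f ∘ suc) (g ∘ suc)))
        (interchange (f zero) (g zero) _ _)

sum-tabulate-0 : ∀ n → sum (tabulate {n = n} (λ _ → 0)) ≡ 0
sum-tabulate-0 zero    = refl
sum-tabulate-0 (suc n) = sum-tabulate-0 n

indicator : ∀ {n} → Fin n → Fin n → ℕ
indicator a i = if does (i ≟ a) then 1 else 0

indicator-self : ∀ {n} (a : Fin n) → indicator a a ≡ 1
indicator-self a = cong (λ b → if b then 1 else 0) (dec-true (a ≟ a) refl)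

sum-tabulate-indicator : ∀ {n} (a : Fin n) → sum (tabulate (indicator a)) ≡ 1
sum-tabulate-indicator {suc n} zero    = cong suc (sum-tabulate-0 n)
sum-tabulate-indicator {suc n} (suc a) = sum-tabulate-indicator a

Bipartite : Graph → Set
Bipartite G = Σ (Subset (n G)) λ S → ∀ v w → Adj G v w → lookup S v ≢ lookup S w

module _ (G : Graph) where

  Adj-sym : ∀ {v w} → Adj G v w → Adj G w v
  Adj-sym {v} {w} = subst T (adj-sym G v w)

  bipartite? : Dec (Bipartite G)
  bipartite? = anySubset? λ S → all? λ v → all? λ w →
                 T? (adj G v w) →-dec ¬? (lookup S v ≟ᵇ lookup S w)

  circularlyPartite1 : ∀ {v w} → Adj G v w → CircularlyPartite G 1
  circularlyPartite1 p = (λ _ _ _ → 0F) , (λ { 0F → _ , _ , p , refl }) , (λ _ _ _ _ _ _ → refl)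

  bipartite⇒circularlyPartite2 : ∀ {v₀ w₀} → Adj G v₀ w₀ → Bipartite G → CircularlyPartite G 2
  bipartite⇒circularlyPartite2 {v₀} {w₀} p₀ (S , proper) = colour , classes , rule
    where
    colour : (v w : Fin (n G)) → Adj G v w → Fin 2
    colour v _ _ = bool→fin2 (lookup S v)
    classes : ∀ j → Σ (Fin (n G)) λ v → Σ (Fin (n G)) λ w → Σ (Adj G v w) λ p → colour v w p ≡ j
    classes j with bool→fin2-covers (proper v₀ w₀ p₀) j
    ... | inj₁ v₀∈j = v₀ , w₀ , p₀ , v₀∈j
    ... | inj₂ w₀∈j = w₀ , v₀ , Adj-sym p₀ , w₀∈j
    rule : ∀ v w z (p : Adj G v w) (q : Adj G w z) → z ≢ v →
           toℕ (colour w z q) ≡ suc (toℕ (colour v w p)) % 2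
    rule v w _ p _ _ = bool→fin2-successor (proper v w p)

  degree≡sum-tabulate : ∀ w → degree G w ≡ sum (tabulate (λ z → if adj G w z then 1 else 0))
  degree≡sum-tabulate w = cong sum (map-tabulate id (λ z → if adj G w z then 1 else 0))

  neighbours⊆pair⇒degree≤2 : ∀ w a b → (∀ z → Adj G w z → z ≡ a ⊎ z ≡ b) → degree G w ≤ 2
  neighbours⊆pair⇒degree≤2 w a b ⊆ = begin
    degree G w
      ≡⟨ degree≡sum-tabulate w ⟩
    sum (tabulate (λ z → if adj G w z then 1 else 0))
      ≤⟨ sum-tabulate-mono bound ⟩
    sum (tabulate (λ z → indicator a z + indicator b z))
      ≡⟨ sum-tabulate-+ (indicator a) (indicator b) ⟩
    sum (tabulate (indicator a)) + sum (tabulate (indicator b))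
      ≡⟨ cong₂ _+_ (sum-tabulate-indicator a) (sum-tabulate-indicator b) ⟩
    2 ∎
    where
    open ≤-Reasoning
    bound : ∀ z → (if adj G w z then 1 else 0) ≤ indicator a z + indicator b z
    bound z with adj G w z in adj≡
    ... | false = z≤n
    ... | true with ⊆ z (subst T (sym adj≡) tt)
    ... | inj₁ refl = ≤-trans (≤-reflexive (sym (indicator-self a))) (m≤m+n _ _)
    ... | inj₂ refl = ≤-trans (≤-reflexive (sym (indicator-self b))) (m≤n+m _ _)

  neighbour-avoiding : ∀ {w} → 3 ≤ degree G w → ∀ a b → ∃[ z ] Adj G w z × z ≢ a × z ≢ b
  neighbour-avoiding {w} 3≤deg a b
    with any? (λ z → T? (adj G w z) ×-dec ¬? (z ≟ a) ×-dec ¬? (z ≟ b))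
  ... | yes found = found
  ... | no none   = ⊥-elim (3≰2 (≤-trans 3≤deg (neighbours⊆pair⇒degree≤2 w a b ⊆)))
    where
    3≰2 : ¬ 3 ≤ 2
    3≰2 (s≤s (s≤s ()))
    ⊆ : ∀ z → Adj G w z → z ≡ a ⊎ z ≡ b
    ⊆ z p with z ≟ a | z ≟ b
    ... | yes z≡a | _       = inj₁ z≡a
    ... | no _    | yes z≡b = inj₂ z≡b
    ... | no z≢a  | no z≢b  = ⊥-elim (none (z , p , z≢a , z≢b))

  module _ (δ≥3 : ∀ w → 3 ≤ degree G w) where

    module _ {m} (c : (v w : Fin (n G)) → Adj G v w → Fin (suc m))
             (rule : ∀ v w z (p : Adj G v w) (q : Adj G w z) → z ≢ v →
                     toℕ (c w z q) ≡ suc (toℕ (c v w p)) % suc m) where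

      outgoing-colour-unique : ∀ {w a b} (pa : Adj G w a) (pb : Adj G w b) → c w a pa ≡ c w b pb
      outgoing-colour-unique {w} {a} {b} pa pb with neighbour-avoiding (δ≥3 w) a b
      ... | u , pu , u≢a , u≢b = toℕ-injective (trans (rule u w a (Adj-sym pu) pa (u≢a ∘ sym))
                                                     (sym (rule u w b (Adj-sym pu) pb (u≢b ∘ sym))))

      reverse-colour : ∀ {v w} (p : Adj G v w) (q : Adj G w v) →
                       toℕ (c w v q) ≡ suc (toℕ (c v w p)) % suc m
      reverse-colour {v} {w} p q with neighbour-avoiding (δ≥3 w) v v
      ... | z , pz , z≢v , _ = trans (cong toℕ (outgoing-colour-unique q pz)) (rule v w z p pz z≢v)

    circularlyPartite⇒≤2 : ∀ {k} → CircularlyPartite G k → k ≤ 2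
    circularlyPartite⇒≤2 {suc m} (c , classes , rule) with classes 0F
    ... | _ , _ , p , _ = m≡[1+n]%o∧n≡[1+m]%o⇒o≤2 (suc m) (reverse-colour c rule (Adj-sym p) p)
                                                         (reverse-colour c rule p (Adj-sym p))

    circularlyPartite2⇒bipartite : CircularlyPartite G 2 → Bipartite G
    circularlyPartite2⇒bipartite (c , _ , rule) = tabulateᵛ side , proper
      where
      out-neighbour : Fin (n G) → Fin (n G)
      out-neighbour v = proj₁ (neighbour-avoiding (δ≥3 v) v v)
      out-neighbour-adj : ∀ v → Adj G v (out-neighbour v)
      out-neighbour-adj v = proj₁ (proj₂ (neighbour-avoiding (δ≥3 v) v v))
      side : Fin (n G) → Bool
      side v = fin2→bool (c v (out-neighbour v) (out-neighbour-adj v))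
      side≡ : ∀ {v w} (p : Adj G v w) → lookup (tabulateᵛ side) v ≡ fin2→bool (c v w p)
      side≡ {v} p = trans (lookup∘tabulate side v)
                          (cong fin2→bool (outgoing-colour-unique c rule (out-neighbour-adj v) p))
      proper : ∀ v w → Adj G v w → lookup (tabulateᵛ side) v ≢ lookup (tabulateᵛ side) w
      proper v w p same = successor-mod-2⇒fin2→bool-≢ _ _ (reverse-colour c rule p (Adj-sym p))
                            (trans (sym (side≡ p)) (trans same (side≡ (Adj-sym p))))

    bipartite⇒χᵒ≡2 : ∀ {v w} → Adj G v w → Bipartite G →
                     IsOrientedEdgePeriodicColouringNumber G 2
    bipartite⇒χᵒ≡2 p bip = bipartite⇒circularlyPartite2 p bip , λ _ → circularlyPartite⇒≤2

    ¬bipartite⇒χᵒ≡1 : ∀ {v w} → Adj G v w → ¬ Bipartite G →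
                      IsOrientedEdgePeriodicColouringNumber G 1
    ¬bipartite⇒χᵒ≡1 p ¬bip = circularlyPartite1 p , λ _ → circularlyPartite⇒≤1
      where
      circularlyPartite⇒≤1 : ∀ {k} → CircularlyPartite G k → k ≤ 1
      circularlyPartite⇒≤1 cp = s≤s⁻¹ (≤∧≢⇒< (circularlyPartite⇒≤2 cp)
                                        λ { refl → ¬bip (circularlyPartite2⇒bipartite cp) })

    χᵒ≡1∨2 : Fin (n G) →
             Σ ℕ λ k → IsOrientedEdgePeriodicColouringNumber G k × (k ≡ 1 ⊎ k ≡ 2)
    χᵒ≡1∨2 v with neighbour-avoiding (δ≥3 v) v v | bipartite?
    ... | _ , p , _ | yes bip = 2 , bipartite⇒χᵒ≡2 p bip , inj₂ refl
    ... | _ , p , _ | no ¬bip = 1 , ¬bipartite⇒χᵒ≡1 p ¬bip , inj₁ refl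

proposition3p4 : (d : ℕ) → 3 ≤ d → (G : Graph) → Connected G → Regular d G →
    Σ ℕ (λ k → IsOrientedEdgePeriodicColouringNumber G k × (k ≡ 1 ⊎ k ≡ 2))
proposition3p4 d 3≤d G (0<n , _) regular = χᵒ≡1∨2 G δ≥3 (fromℕ< 0<n)
  where
  δ≥3 : ∀ w → 3 ≤ degree G w
  δ≥3 w = subst (3 ≤_) (sym (regular w)) 3≤d
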